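{- Let $\Sigma=\{a_1,\dots,a_\sigma\}$ be an ordered alphabet with $a_1<\dots<a_\sigma$. For any $\sigma$ and $n$ such that $\sigma<n$, write $n=m\sigma+p$ with integers $m$ and $0\le p<\sigma$. Then the maximum, over all strings $w\in\Sigma^n$, of the total number of Lyndon substrings of $w$ is \[ \mathit{MTF}(\sigma,n)=\binom{n+1}{2}-(\sigma-p)\binom{m+1}{2}-p\binom{m+2}{2}+n . \] Moreover, the number of strings in $\Sigma^n$ that contain exactly $\mathit{MTF}(\sigma,n)$ Lyndon substrings is $\binom{\sigma}{p}$, and the string $w={a_1}^m\cdots{a_{\sigma-p}}^m\,{a_{\sigma-p+1}}^{m+1}\cdots{a_\sigma}^{m+1}$ is one such string.
   Context: A string $w$ over an ordered alphabet is a Lyndon word if it is non-empty and lexicographically strictly smaller than all its non-empty proper suffixes (equivalently, it is the lexicographically smallest among its conjugates). A substring (factor) of $w$ is $w[i..j]=w[i]w[i+1]\cdots w[j]$ for $1\le i\le j\le |w|$. The total number of Lyndon substrings of $w$ is the number of pairs $(i,j)$ with $1\le i\le j\le|w|$ such that $w[i..j]$ is a Lyndon word (occurrences are counted, not distinct strings). $\mathit{MTF}(\sigma,n)$ denotes the maximum of this quantity over all strings of length $n$ over an alphabet of size $\sigma$. -}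

module Defs where

open import Data.Nat using (ℕ; zero; suc; _+_; _*_; _∸_; _<ᵇ_; _≤ᵇ_)
open import Data.Nat.Combinatorics using (_C_)
open import Data.Bool using (Bool; true; false; _∧_; _∨_; not; if_then_else_)
open import Data.Fin using (Fin; toℕ)

open import Data.List using (List; []; _∷_; length; replicate; concatMap; drop; take; upTo; allFin)


-- Alphabet Σ = Fin σ, ordered by the natural order a₁ < … < a_σ (i.e. 0 < 1 < … < σ-1).

_<lex_ : ∀ {σ} → List (Fin σ) → List (Fin σ) → Bool
[]      <lex []      = false
[]      <lex (_ ∷ _) = true
(_ ∷ _) <lex []      = false
(x ∷ u) <lex (y ∷ v) =
  (toℕ x <ᵇ toℕ y) ∨ ((toℕ x ≤ᵇ toℕ y) ∧ (toℕ y ≤ᵇ toℕ x) ∧ (u <lex v))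

properSuffixes : ∀ {σ} → List (Fin σ) → List (List (Fin σ))
properSuffixes []      = []
properSuffixes (_ ∷ []) = []
properSuffixes (_ ∷ v@(_ ∷ _)) = v ∷ properSuffixes v

allB : ∀ {A : Set} → (A → Bool) → List A → Bool
allB p []       = true
allB p (x ∷ xs) = p x ∧ allB p xs

isLyndon : ∀ {σ} → List (Fin σ) → Bool
isLyndon []         = false
isLyndon w@(_ ∷ _)  = allB (λ s → w <lex s) (properSuffixes w)

count : ∀ {A : Set} → (A → Bool) → List A → ℕ
count p []       = 0
count p (x ∷ xs) = (if p x then 1 else 0) + count p xs

lyndonPrefixes : ∀ {σ} → List (Fin σ) → ℕ
lyndonPrefixes w = count (λ j → isLyndon (take (suc j) w)) (upTo (length w))

-- total number of Lyndon substrings (occurrences): pairs (i,j) with w[i..j] Lyndon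
lyndonSubstrings : ∀ {σ} → List (Fin σ) → ℕ
lyndonSubstrings []           = 0
lyndonSubstrings w@(_ ∷ rest) = lyndonPrefixes w + lyndonSubstrings rest

mtfFormula : ℕ → ℕ → ℕ → ℕ → ℕ
mtfFormula σ n m p =
  ((suc n) C 2 + n) ∸ ((σ ∸ p) * ((suc m) C 2) + p * ((suc (suc m)) C 2))

witness : (σ m p : ℕ) → List (Fin σ)
witness σ m p =
  concatMap (λ i → replicate (if toℕ i <ᵇ (σ ∸ p) then m else suc m) i) (allFin σ)

-- A Lyndon word of length at least two ends with a letter larger than its first one.
-- Hence the Lyndon substrings starting at a position i number at most 1 + #{j > i : w_j > w_i},
-- and summing over i gives L + E + D ≤ C(n+1, 2), where E counts the pairs of positions
-- carrying equal letters and D the inversions; a sorted word attains this with D = 0,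
-- because each of its prefixes whose last letter exceeds the first is Lyndon.
-- Writing c_a for the number of occurrences of the letter a, E = Σ_a C(c_a, 2), and
-- C(c, 2) + C(m+1, 2) = m c + δ_m(c) with δ_m(c) ≥ 0 vanishing exactly at c ∈ {m, m+1}.
-- So L ≤ MTF(σ, n), with equality iff w is sorted and every letter occurs m or m+1 times.
-- Such a word is determined by the p letters occurring m+1 times.

module Submission where

open import Data.Bool using (Bool; true; false; T; _∧_; _∨_; if_then_else_)
open import Data.Bool.Properties using (T-∧; T-∨)
open import Data.Empty using (⊥-elim)
open import Data.Fin as Fin using (Fin; toℕ)
open import Data.Fin.Properties using (toℕ-injective; +↔⊎)
open import Data.Fin.Subset using (Subset; ∣_∣)
open import Data.List using (List; []; _∷_; _++_; length; take; upTo; applyUpTo; map; replicate; concatMap; tabulate)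
open import Data.List.Properties using (map-++; map-replicate; map-∘; map-id)
open import Data.List.Relation.Unary.All as All using (All; []; _∷_)
open import Data.List.Relation.Unary.All.Properties as All using ()
open import Data.List.Relation.Unary.AllPairs as AllPairs using (AllPairs; []; _∷_)
open import Data.List.Relation.Unary.AllPairs.Properties as AllPairs using ()
open import Data.Nat using (ℕ; zero; suc; _+_; _*_; _∸_; _<_; _≤_; _<ᵇ_; _≤ᵇ_; _≡ᵇ_; z≤n; s≤s)
open import Data.Nat.Combinatorics using (_C_; nC1≡n; nCk+nC[k+1]≡[n+1]C[k+1])
open import Data.Nat.Properties
open import Algebra.Properties.CommutativeSemigroup +-commutativeSemigroup using (interchange; xy∙z≈xz∙y)
open import Algebra.Properties.Semiring.Sum +-*-semiring
  using (sum-syntax; sum-cong-≗; sum-replicate-zero; ∑-distrib-+; *-distribˡ-sum)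
open import Data.Nat.Tactic.RingSolver using (solve-∀)
open import Data.Product using (Σ; _×_; _,_; proj₁; proj₂)
open import Data.Sum using (_⊎_; inj₁; inj₂)
open import Data.Sum.Function.Propositional using (_⊎-↔_)
open import Data.Unit using (tt)
open import Data.Vec as Vec using ([]; _∷_; lookup)
open import Data.Vec.Properties using (lookup∘tabulate; tabulate∘lookup; tabulate-cong)
open import Defs
open import Function using (_∘_; id)
open import Function.Bundles using (Equivalence; _↔_; mk↔ₛ′)
open import Function.Properties.Inverse using (↔-refl; ↔-sym; ↔-trans)
open import Relation.Binary.Definitions using (tri<; tri≈; tri>)
open import Relation.Binary.PropositionalEquality
open import Relation.Nullary using (¬_)

T-∧-intro : ∀ {a b} → T a → T b → T (a ∧ b)
T-∧-intro ta tb = Equivalence.from T-∧ (ta , tb)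

T⇔⇒≡ : ∀ {a b} → (T a → T b) → (T b → T a) → a ≡ b
T⇔⇒≡ {false} {false} _   _   = refl
T⇔⇒≡ {false} {true}  _   b⇒a = ⊥-elim (b⇒a tt)
T⇔⇒≡ {true}  {false} a⇒b _   = ⊥-elim (a⇒b tt)
T⇔⇒≡ {true}  {true}  _   _   = refl

<ᵇ-irrefl : ∀ n → (n <ᵇ n) ≡ false
<ᵇ-irrefl zero    = refl
<ᵇ-irrefl (suc n) = <ᵇ-irrefl n

n<ᵇ1+n : ∀ n → (n <ᵇ suc n) ≡ true
n<ᵇ1+n zero    = refl
n<ᵇ1+n (suc n) = n<ᵇ1+n n

≤ᵇ-refl : ∀ n → (n ≤ᵇ n) ≡ true
≤ᵇ-refl zero    = refl
≤ᵇ-refl (suc n) = n<ᵇ1+n n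

≡ᵇ-refl : ∀ n → (n ≡ᵇ n) ≡ true
≡ᵇ-refl zero    = refl
≡ᵇ-refl (suc n) = ≡ᵇ-refl n

≡ᵇ-1+n : ∀ n → (n ≡ᵇ suc n) ≡ false
≡ᵇ-1+n zero    = refl
≡ᵇ-1+n (suc n) = ≡ᵇ-1+n n

module _ {A : Set} where

  count-cong : ∀ {p q : A → Bool} → (∀ x → p x ≡ q x) → ∀ xs → count p xs ≡ count q xs
  count-cong p≗q []       = refl
  count-cong p≗q (x ∷ xs) = cong₂ (λ b k → (if b then 1 else 0) + k) (p≗q x) (count-cong p≗q xs)

  count-mono : ∀ {p q : A → Bool} → (∀ x → T (p x) → T (q x)) → ∀ xs → count p xs ≤ count q xs
  count-mono p⇒q []       = z≤n
  count-mono p⇒q (x ∷ xs) = +-mono-≤ (indicator-mono (p⇒q x)) (count-mono p⇒q xs)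
    where
    indicator-mono : ∀ {a b} → (T a → T b) → (if a then 1 else 0) ≤ (if b then 1 else 0)
    indicator-mono {false}         _   = z≤n
    indicator-mono {true}  {true}  _   = ≤-refl
    indicator-mono {true}  {false} a⇒b = ⊥-elim (a⇒b tt)

  count-none : ∀ {p : A → Bool} {xs} → All (λ x → ¬ T (p x)) xs → count p xs ≡ 0
  count-none []                          = refl
  count-none {p} {x ∷ _} (¬px ∷ ¬pxs) with p x
  ... | true  = ⊥-elim (¬px tt)
  ... | false = count-none ¬pxs

  count≡0⇒none : ∀ {p : A → Bool} xs → count p xs ≡ 0 → All (λ x → ¬ T (p x)) xs
  count≡0⇒none         []       _  = []
  count≡0⇒none {p = p} (x ∷ xs) eq with p x in px≡false
  ... | false = (λ px → subst T px≡false px) ∷ count≡0⇒none xs eq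

  count-++ : ∀ (p : A → Bool) xs ys → count p (xs ++ ys) ≡ count p xs + count p ys
  count-++ p []       ys = refl
  count-++ p (x ∷ xs) ys =
    trans (cong (_ +_) (count-++ p xs ys)) (sym (+-assoc (if p x then 1 else 0) (count p xs) (count p ys)))

  count-map : ∀ {B : Set} (p : B → Bool) (f : A → B) xs → count p (map f xs) ≡ count (p ∘ f) xs
  count-map p f []       = refl
  count-map p f (x ∷ xs) = cong (_ +_) (count-map p f xs)

  lastOr : A → List A → A
  lastOr d []       = d
  lastOr d (y ∷ ys) = lastOr y ys

count-applyUpTo : ∀ (h : ℕ → Bool) f n → count h (applyUpTo f n) ≡ count (h ∘ f) (upTo n)
count-applyUpTo h f zero    = refl
count-applyUpTo h f (suc n) = cong (_ +_)
  (trans (count-applyUpTo h (f ∘ suc) n) (sym (count-applyUpTo (h ∘ f) suc n)))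

-- The last letters of the non-empty prefixes of xs are the letters of xs.
count-lastOr-take : ∀ {A : Set} (r : A → Bool) d xs →
  count (λ j → r (lastOr d (take (suc j) xs))) (upTo (length xs)) ≡ count r xs
count-lastOr-take r d []       = refl
count-lastOr-take r d (y ∷ ys) = cong (_ +_)
  (trans (count-applyUpTo _ suc (length ys)) (count-lastOr-take r y ys))

-- Lyndon words

module _ {σ : ℕ} where

  Word : Set
  Word = List (Fin σ)

  Sorted : Word → Set
  Sorted = AllPairs Fin._≤_

  suffixes⁺ : Word → List Word
  suffixes⁺ u = u ∷ properSuffixes u

  <lex-head< : ∀ {x y : Fin σ} u v → x Fin.< y → T ((x ∷ u) <lex (y ∷ v))
  <lex-head< u v x<y = Equivalence.from T-∨ (inj₁ (<⇒<ᵇ x<y))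

  <lex-head≡ : ∀ {x y : Fin σ} u v → toℕ x ≡ toℕ y → (x ∷ u) <lex (y ∷ v) ≡ u <lex v
  <lex-head≡ {y = y} u v x≡y rewrite x≡y | <ᵇ-irrefl (toℕ y) | ≤ᵇ-refl (toℕ y) = refl

  <lex-head≤ : ∀ {x y : Fin σ} u v → x Fin.≤ y → T (u <lex v) → T ((x ∷ u) <lex (y ∷ v))
  <lex-head≤ u v x≤y u<v with m≤n⇒m<n∨m≡n x≤y
  ... | inj₁ x<y = <lex-head< u v x<y
  ... | inj₂ x≡y = subst T (sym (<lex-head≡ u v x≡y)) u<v

  allB-suffixes⁺-last : ∀ (P : Word → Bool) y v → T (allB P (suffixes⁺ (y ∷ v))) → T (P (lastOr y v ∷ []))
  allB-suffixes⁺-last P y []      h = proj₁ (Equivalence.to T-∧ h)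
  allB-suffixes⁺-last P y (z ∷ v) h =
    allB-suffixes⁺-last P z v (proj₂ (Equivalence.to (T-∧ {P (y ∷ z ∷ v)}) h))

  -- The last letter l is itself a suffix, and x ∷ y ∷ v <lex [ l ] forces x < l.
  isLyndon⇒head<last : ∀ x y v → T (isLyndon (x ∷ y ∷ v)) → x Fin.< lastOr y v
  isLyndon⇒head<last x y v h = <ᵇ⇒< _ _ (first-disjunct _ (toℕ x ≤ᵇ toℕ l) (toℕ l ≤ᵇ toℕ x)
                                           (allB-suffixes⁺-last ((x ∷ y ∷ v) <lex_) y v h))
    where
    l = lastOr y v
    first-disjunct : ∀ a b c → T (a ∨ (b ∧ c ∧ false)) → T a
    first-disjunct true  _     _     _ = tt
    first-disjunct false true  true  ()
    first-disjunct false true  false ()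
    first-disjunct false false _     ()

  <lex-suffixes⁺-above : ∀ {x} w c t → All (x Fin.<_) (c ∷ t) →
    T (allB ((x ∷ w) <lex_) (suffixes⁺ (c ∷ t)))
  <lex-suffixes⁺-above w c []       (x<c ∷ _)   = T-∧-intro (<lex-head< w [] x<c) tt
  <lex-suffixes⁺-above w c (c′ ∷ t) (x<c ∷ x<t) =
    T-∧-intro (<lex-head< w (c′ ∷ t) x<c) (<lex-suffixes⁺-above w c′ t x<t)

  -- Against a suffix that also starts with x, the comparison of x ∷ w passes to w and a proper suffix.
  <lex-suffixes⁺-prepend : ∀ {x} w c t → All (x Fin.≤_) (c ∷ t) → x Fin.< lastOr c t →
    T (allB (w <lex_) (properSuffixes (c ∷ t))) → T (allB ((x ∷ w) <lex_) (suffixes⁺ (c ∷ t)))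
  <lex-suffixes⁺-prepend w c []       _           x<c _ = T-∧-intro (<lex-head< w [] x<c) tt
  <lex-suffixes⁺-prepend w c (c′ ∷ t) (x≤c ∷ x≤t) x<l h with Equivalence.to T-∧ h
  ... | w<c′t , w<t =
    T-∧-intro (<lex-head≤ w (c′ ∷ t) x≤c w<c′t) (<lex-suffixes⁺-prepend w c′ t x≤t x<l w<t)

  sorted⇒isLyndon : ∀ x v → Sorted (x ∷ v) → x Fin.< lastOr x v → T (isLyndon (x ∷ v))
  sorted⇒isLyndon x []      _                           _   = tt
  sorted⇒isLyndon x (z ∷ v) (x≤zv ∷ sorted@(z≤v ∷ _)) x<l with m≤n⇒m<n∨m≡n (All.head x≤zv)
  ... | inj₁ x<z = <lex-suffixes⁺-above (z ∷ v) z v (x<z ∷ All.map (<-≤-trans x<z) z≤v)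
  ... | inj₂ x≡z = <lex-suffixes⁺-prepend (z ∷ v) z v x≤zv x<l
    (sorted⇒isLyndon z v sorted (subst (_< toℕ (lastOr z v)) x≡z x<l))

  isLyndon-sorted : ∀ x y v → Sorted (x ∷ y ∷ v) → isLyndon (x ∷ y ∷ v) ≡ (toℕ x <ᵇ toℕ (lastOr y v))
  isLyndon-sorted x y v sorted = T⇔⇒≡
    (<⇒<ᵇ ∘ isLyndon⇒head<last x y v)
    (sorted⇒isLyndon x (y ∷ v) sorted ∘ <ᵇ⇒< _ _)

-- Lyndon prefixes and pairs of positions

pairs : ℕ → ℕ
pairs zero    = 0
pairs (suc k) = k + pairs k

C2≡pairs : ∀ k → k C 2 ≡ pairs k
C2≡pairs zero    = refl
C2≡pairs (suc k) = trans (sym (nCk+nC[k+1]≡[n+1]C[k+1] k 1)) (cong₂ _+_ (nC1≡n k) (C2≡pairs k))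

+-interchange₃ : ∀ a b c d e f → (a + b) + (c + d) + (e + f) ≡ (a + c + e) + (b + d + f)
+-interchange₃ = solve-∀

indicator-trichotomy : ∀ a b →
  (if a <ᵇ b then 1 else 0) + (if a ≡ᵇ b then 1 else 0) + (if b <ᵇ a then 1 else 0) ≡ 1
indicator-trichotomy zero    zero    = refl
indicator-trichotomy zero    (suc b) = refl
indicator-trichotomy (suc a) zero    = refl
indicator-trichotomy (suc a) (suc b) = indicator-trichotomy a b

module _ {σ : ℕ} where

  ascends sameLetter descends : Fin σ → Fin σ → Bool
  ascends    x y = toℕ x <ᵇ toℕ y
  sameLetter x y = toℕ x ≡ᵇ toℕ y
  descends   x y = toℕ y <ᵇ toℕ x

  lyndonPrefixes-∷ : ∀ x (xs : Word {σ}) →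
    lyndonPrefixes (x ∷ xs) ≡ suc (count (λ j → isLyndon (x ∷ take (suc j) xs)) (upTo (length xs)))
  lyndonPrefixes-∷ x xs = cong suc (count-applyUpTo (λ j → isLyndon (take (suc j) (x ∷ xs))) suc (length xs))

  lyndonPrefixes≤ : ∀ x xs → lyndonPrefixes (x ∷ xs) ≤ suc (count (ascends x) xs)
  lyndonPrefixes≤ x []       = ≤-refl
  lyndonPrefixes≤ x (y ∷ ys) = begin
    lyndonPrefixes (x ∷ y ∷ ys)
      ≡⟨ lyndonPrefixes-∷ x (y ∷ ys) ⟩
    suc (count (λ j → isLyndon (x ∷ take (suc j) (y ∷ ys))) (upTo (length (y ∷ ys))))
      ≤⟨ s≤s (count-mono {p = λ j → isLyndon (x ∷ take (suc j) (y ∷ ys))}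
               (λ j → <⇒<ᵇ ∘ isLyndon⇒head<last x y (take j ys)) (upTo (length (y ∷ ys)))) ⟩
    suc (count (λ j → ascends x (lastOr x (take (suc j) (y ∷ ys)))) (upTo (length (y ∷ ys))))
      ≡⟨ cong suc (count-lastOr-take (ascends x) x (y ∷ ys)) ⟩
    suc (count (ascends x) (y ∷ ys)) ∎
    where open ≤-Reasoning

  lyndonPrefixes-sorted : ∀ x xs → Sorted (x ∷ xs) → lyndonPrefixes (x ∷ xs) ≡ suc (count (ascends x) xs)
  lyndonPrefixes-sorted x []       _      = refl
  lyndonPrefixes-sorted x (y ∷ ys) sorted = begin
    lyndonPrefixes (x ∷ y ∷ ys)
      ≡⟨ lyndonPrefixes-∷ x (y ∷ ys) ⟩
    suc (count (λ j → isLyndon (x ∷ take (suc j) (y ∷ ys))) (upTo (length (y ∷ ys))))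
      ≡⟨ cong suc (count-cong (λ j → isLyndon-sorted x y (take j ys) (AllPairs.take⁺ (suc (suc j)) sorted))
                              (upTo (length (y ∷ ys)))) ⟩
    suc (count (λ j → ascends x (lastOr x (take (suc j) (y ∷ ys)))) (upTo (length (y ∷ ys))))
      ≡⟨ cong suc (count-lastOr-take (ascends x) x (y ∷ ys)) ⟩
    suc (count (ascends x) (y ∷ ys)) ∎
    where open ≡-Reasoning

  count-trichotomy : ∀ x xs →
    count (ascends x) xs + count (sameLetter x) xs + count (descends x) xs ≡ length xs
  count-trichotomy x []       = refl
  count-trichotomy x (y ∷ ys) = begin
    (a + as) + (e + es) + (d + ds)  ≡⟨ +-interchange₃ a as e es d ds ⟩
    (a + e + d) + (as + es + ds)    ≡⟨ cong₂ _+_ (indicator-trichotomy (toℕ x) (toℕ y)) (count-trichotomy x ys) ⟩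
    suc (length ys)                 ∎
    where
    open ≡-Reasoning
    a  = if ascends x y then 1 else 0
    e  = if sameLetter x y then 1 else 0
    d  = if descends x y then 1 else 0
    as = count (ascends x) ys
    es = count (sameLetter x) ys
    ds = count (descends x) ys

  ≤⇒not-descends : ∀ {x y} → x Fin.≤ y → ¬ T (descends x y)
  ≤⇒not-descends x≤y y<x = <⇒≱ (<ᵇ⇒< _ _ y<x) x≤y

  not-descends⇒≤ : ∀ {x y} → ¬ T (descends x y) → x Fin.≤ y
  not-descends⇒≤ ¬y<x = ≮⇒≥ (¬y<x ∘ <⇒<ᵇ)

  equalPairs inversions : Word {σ} → ℕ
  equalPairs []       = 0
  equalPairs (x ∷ xs) = count (sameLetter x) xs + equalPairs xs
  inversions []       = 0
  inversions (x ∷ xs) = count (descends x) xs + inversions xs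

  lyndonSubstrings-bound : ∀ w → lyndonSubstrings w + equalPairs w + inversions w ≤ pairs (suc (length w))
  lyndonSubstrings-bound []       = z≤n
  lyndonSubstrings-bound (x ∷ xs) = begin
    (lp + L) + (e + E) + (d + D)  ≡⟨ +-interchange₃ lp L e E d D ⟩
    (lp + e + d) + (L + E + D)    ≤⟨ +-mono-≤ (+-monoˡ-≤ d (+-monoˡ-≤ e (lyndonPrefixes≤ x xs)))
                                              (lyndonSubstrings-bound xs) ⟩
    suc (a + e + d) + pairs (suc n) ≡⟨ cong (λ k → suc k + pairs (suc n)) (count-trichotomy x xs) ⟩
    pairs (suc (suc n))           ∎
    where
    open ≤-Reasoning
    n  = length xs
    lp = lyndonPrefixes (x ∷ xs)
    L  = lyndonSubstrings xs
    E  = equalPairs xs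
    D  = inversions xs
    a  = count (ascends x) xs
    e  = count (sameLetter x) xs
    d  = count (descends x) xs

  lyndonSubstrings-sorted : ∀ w → Sorted w → lyndonSubstrings w + equalPairs w ≡ pairs (suc (length w))
  lyndonSubstrings-sorted []       _                           = refl
  lyndonSubstrings-sorted (x ∷ xs) sorted@(x≤xs ∷ sorted-xs) = begin
    (lp + L) + (e + E)           ≡⟨ interchange lp L e E ⟩
    (lp + e) + (L + E)           ≡⟨ cong₂ (λ k l → k + e + l) (lyndonPrefixes-sorted x xs sorted)
                                                              (lyndonSubstrings-sorted xs sorted-xs) ⟩
    suc (a + e) + pairs (suc n)  ≡⟨ cong (λ k → suc k + pairs (suc n)) a+e≡n ⟩
    pairs (suc (suc n))          ∎
    where
    open ≡-Reasoning
    n  = length xs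
    lp = lyndonPrefixes (x ∷ xs)
    L  = lyndonSubstrings xs
    E  = equalPairs xs
    a  = count (ascends x) xs
    e  = count (sameLetter x) xs
    a+e≡n : a + e ≡ n
    a+e≡n = begin
      a + e                          ≡⟨ +-identityʳ (a + e) ⟨
      a + e + 0                      ≡⟨ cong (a + e +_) (count-none (All.map ≤⇒not-descends x≤xs)) ⟨
      a + e + count (descends x) xs  ≡⟨ count-trichotomy x xs ⟩
      n                              ∎

  inversions≡0⇒sorted : ∀ w → inversions w ≡ 0 → Sorted w
  inversions≡0⇒sorted []       _   = []
  inversions≡0⇒sorted (x ∷ xs) D≡0 =
    All.map not-descends⇒≤ (count≡0⇒none xs (m+n≡0⇒m≡0 _ D≡0))
    ∷ inversions≡0⇒sorted xs (m+n≡0⇒n≡0 (count (descends x) xs) D≡0)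

-- Letter multiplicities

occ : ∀ {σ} → Fin σ → Word {σ} → ℕ
occ i = count (sameLetter i)

pairs-indicator : ∀ b k → pairs ((if b then 1 else 0) + k) ≡ (if b then k else 0) + pairs k
pairs-indicator false k = refl
pairs-indicator true  k = refl

∑-const : ∀ σ k → ∑[ i < σ ] k ≡ σ * k
∑-const zero    k = refl
∑-const (suc σ) k = cong (k +_) (∑-const σ k)

∑≡0⇒≡0 : ∀ {σ} (f : Fin σ → ℕ) → ∑[ i < σ ] f i ≡ 0 → ∀ i → f i ≡ 0
∑≡0⇒≡0 f ∑f≡0 Fin.zero    = m+n≡0⇒m≡0 _ ∑f≡0
∑≡0⇒≡0 f ∑f≡0 (Fin.suc i) = ∑≡0⇒≡0 (f ∘ Fin.suc) (m+n≡0⇒n≡0 (f Fin.zero) ∑f≡0) i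

∑-select : ∀ {σ} (f : Fin σ → ℕ) x → ∑[ i < σ ] (if sameLetter i x then f i else 0) ≡ f x
∑-select {suc σ} f Fin.zero    = trans (cong (f Fin.zero +_) (sum-replicate-zero σ)) (+-identityʳ _)
∑-select {suc σ} f (Fin.suc x) = ∑-select (f ∘ Fin.suc) x

∑-occ : ∀ {σ} (w : Word {σ}) → ∑[ i < σ ] occ i w ≡ length w
∑-occ {σ} []       = sum-replicate-zero σ
∑-occ {σ} (x ∷ xs) = begin
  ∑[ i < σ ] ((if sameLetter i x then 1 else 0) + occ i xs)           ≡⟨ ∑-distrib-+ {σ} _ _ ⟩
  ∑[ i < σ ] (if sameLetter i x then 1 else 0) + ∑[ i < σ ] occ i xs  ≡⟨ cong₂ _+_ (∑-select _ x) (∑-occ xs) ⟩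
  suc (length xs)                                                     ∎
  where open ≡-Reasoning

equalPairs≡∑pairs-occ : ∀ {σ} (w : Word {σ}) → equalPairs w ≡ ∑[ i < σ ] pairs (occ i w)
equalPairs≡∑pairs-occ {σ} []       = sym (sum-replicate-zero σ)
equalPairs≡∑pairs-occ {σ} (x ∷ xs) = sym (begin
  ∑[ i < σ ] pairs (occ i (x ∷ xs))
    ≡⟨ sum-cong-≗ (λ i → pairs-indicator (sameLetter i x) (occ i xs)) ⟩
  ∑[ i < σ ] ((if sameLetter i x then occ i xs else 0) + pairs (occ i xs))
    ≡⟨ ∑-distrib-+ {σ} _ _ ⟩
  ∑[ i < σ ] (if sameLetter i x then occ i xs else 0) + ∑[ i < σ ] pairs (occ i xs)
    ≡⟨ cong₂ _+_ (∑-select _ x) (sym (equalPairs≡∑pairs-occ xs)) ⟩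
  occ x xs + equalPairs xs ∎)
  where open ≡-Reasoning

-- deviation m c is C(m − c + 1, 2) for c ≤ m and C(c − m, 2) for c > m.
deviation : ℕ → ℕ → ℕ
deviation zero    c       = pairs c
deviation (suc m) zero    = pairs (suc (suc m))
deviation (suc m) (suc c) = deviation m c

pairs-deviation : ∀ m c → pairs c + pairs (suc m) ≡ m * c + deviation m c
pairs-deviation zero    c       = +-identityʳ (pairs c)
pairs-deviation (suc m) zero    = cong (_+ pairs (suc (suc m))) (sym (*-zeroʳ m))
pairs-deviation (suc m) (suc c) = begin
  (c + pairs c) + (suc m + pairs (suc m))  ≡⟨ shuffle c m (pairs c) (pairs (suc m)) ⟩
  (pairs c + pairs (suc m)) + (c + suc m)  ≡⟨ cong (_+ (c + suc m)) (pairs-deviation m c) ⟩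
  (m * c + deviation m c) + (c + suc m)    ≡⟨ regroup m c (deviation m c) ⟩
  suc m * suc c + deviation m c            ∎
  where
  open ≡-Reasoning
  shuffle : ∀ c m pc pm → (c + pc) + (suc m + pm) ≡ (pc + pm) + (c + suc m)
  shuffle = solve-∀
  regroup : ∀ m c d → (m * c + d) + (c + suc m) ≡ suc m * suc c + d
  regroup = solve-∀

deviation≡0⇒balanced : ∀ m c → deviation m c ≡ 0 → c ≡ m ⊎ c ≡ suc m
deviation≡0⇒balanced zero    zero       _   = inj₁ refl
deviation≡0⇒balanced zero    (suc zero) _   = inj₂ refl
deviation≡0⇒balanced (suc m) (suc c)    dev = Data.Sum.map (cong suc) (cong suc) (deviation≡0⇒balanced m c dev)

deviation-m-m : ∀ m → deviation m m ≡ 0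
deviation-m-m zero    = refl
deviation-m-m (suc m) = deviation-m-m m

deviation-m-1+m : ∀ m → deviation m (suc m) ≡ 0
deviation-m-1+m zero    = refl
deviation-m-1+m (suc m) = deviation-m-1+m m

balanced⇒deviation≡0 : ∀ m c → c ≡ m ⊎ c ≡ suc m → deviation m c ≡ 0
balanced⇒deviation≡0 m _ (inj₁ refl) = deviation-m-m m
balanced⇒deviation≡0 m _ (inj₂ refl) = deviation-m-1+m m

∑-pairs-deviation : ∀ {σ} m (c : Fin σ → ℕ) →
  ∑[ i < σ ] pairs (c i) + σ * pairs (suc m) ≡ m * ∑[ i < σ ] c i + ∑[ i < σ ] deviation m (c i)
∑-pairs-deviation {σ} m c = begin
  ∑[ i < σ ] pairs (c i) + σ * pairs (suc m)           ≡⟨ cong (∑[ i < σ ] pairs (c i) +_) (∑-const σ (pairs (suc m))) ⟨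
  ∑[ i < σ ] pairs (c i) + ∑[ i < σ ] pairs (suc m)    ≡⟨ ∑-distrib-+ {σ} _ _ ⟨
  ∑[ i < σ ] (pairs (c i) + pairs (suc m))             ≡⟨ sum-cong-≗ (pairs-deviation m ∘ c) ⟩
  ∑[ i < σ ] (m * c i + deviation m (c i))             ≡⟨ ∑-distrib-+ {σ} _ _ ⟩
  ∑[ i < σ ] (m * c i) + ∑[ i < σ ] deviation m (c i)  ≡⟨ cong (_+ ∑[ i < σ ] deviation m (c i)) (*-distribˡ-sum m c) ⟨
  m * ∑[ i < σ ] c i + ∑[ i < σ ] deviation m (c i)    ∎
  where open ≡-Reasoning

module _ {σ : ℕ} where

  Balanced : ℕ → Word {σ} → Set
  Balanced m w = ∀ i → occ i w ≡ m ⊎ occ i w ≡ suc m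

  excess : ℕ → Word {σ} → ℕ
  excess m w = ∑[ i < σ ] deviation m (occ i w)

  excess≡0⇒balanced : ∀ m w → excess m w ≡ 0 → Balanced m w
  excess≡0⇒balanced m w X≡0 i = deviation≡0⇒balanced m (occ i w) (∑≡0⇒≡0 _ X≡0 i)

  balanced⇒excess≡0 : ∀ m w → Balanced m w → excess m w ≡ 0
  balanced⇒excess≡0 m w balanced =
    trans (sum-cong-≗ (λ i → balanced⇒deviation≡0 m (occ i w) (balanced i))) (sum-replicate-zero σ)

-- The bound and its equality case

mtfDeficit : ℕ → ℕ → ℕ → ℕ
mtfDeficit σ m p = (σ ∸ p) * pairs (suc m) + p * pairs (suc (suc m))

mtfFormula≡ : ∀ σ n m p → mtfFormula σ n m p ≡ pairs (suc n) + n ∸ mtfDeficit σ m p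
mtfFormula≡ σ n m p rewrite C2≡pairs (suc n) | C2≡pairs (suc m) | C2≡pairs (suc (suc m)) = refl

pairs-suc-double : ∀ m → pairs (suc m) + pairs (suc m) ≡ m * suc m
pairs-suc-double m = begin
  pairs (suc m) + pairs (suc m)    ≡⟨ pairs-deviation m (suc m) ⟩
  m * suc m + deviation m (suc m)  ≡⟨ cong (m * suc m +_) (deviation-m-1+m m) ⟩
  m * suc m + 0                    ≡⟨ +-identityʳ _ ⟩
  m * suc m                        ∎
  where open ≡-Reasoning

mtfDeficit-identity : ∀ σ m p → p ≤ σ →
  mtfDeficit σ m p + σ * pairs (suc m) ≡ (m * σ + p) + m * (m * σ + p)
mtfDeficit-identity σ m p p≤σ with m≤n⇒∃[o]m+o≡n p≤σ
... | q , refl rewrite m+n∸m≡n p q = begin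
  q * t + p * (suc m + t) + (p + q) * t      ≡⟨ regroup₁ p q m t ⟩
  p * suc m + (p + q) * (t + t)              ≡⟨ cong (λ k → p * suc m + (p + q) * k) (pairs-suc-double m) ⟩
  p * suc m + (p + q) * (m * suc m)          ≡⟨ regroup₂ p q m ⟩
  (m * (p + q) + p) + m * (m * (p + q) + p)  ∎
  where
  open ≡-Reasoning
  t = pairs (suc m)
  regroup₁ : ∀ p q m t → q * t + p * (suc m + t) + (p + q) * t ≡ p * suc m + (p + q) * (t + t)
  regroup₁ = solve-∀
  regroup₂ : ∀ p q m → p * suc m + (p + q) * (m * suc m) ≡ (m * (p + q) + p) + m * (m * (p + q) + p)
  regroup₂ = solve-∀

module _ {σ n m p : ℕ} (n≡mσ+p : n ≡ m * σ + p) (p≤σ : p ≤ σ) (w : Word {σ}) (|w|≡n : length w ≡ n) where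

  private
    L = lyndonSubstrings w
    E = equalPairs w
    D = inversions w
    X = excess m w
    K = mtfDeficit σ m p
    N = pairs (suc n) + n

  equalPairs+n≡mtfDeficit+excess : E + n ≡ K + X
  equalPairs+n≡mtfDeficit+excess = +-cancelʳ-≡ (σ * t) _ _ (begin
    E + n + σ * t                           ≡⟨ xy∙z≈xz∙y E n (σ * t) ⟩
    E + σ * t + n                           ≡⟨ cong (λ e → e + σ * t + n) (equalPairs≡∑pairs-occ w) ⟩
    ∑[ i < σ ] pairs (occ i w) + σ * t + n  ≡⟨ cong (_+ n) (∑-pairs-deviation m (λ i → occ i w)) ⟩
    m * ∑[ i < σ ] occ i w + X + n          ≡⟨ cong (λ k → m * k + X + n) (trans (∑-occ w) |w|≡n) ⟩
    m * n + X + n                           ≡⟨ xy∙z≈xz∙y (m * n) X n ⟩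
    m * n + n + X                           ≡⟨ cong (_+ X) (+-comm (m * n) n) ⟩
    n + m * n + X                           ≡⟨ cong (_+ X) K+σt≡n+mn ⟨
    K + σ * t + X                           ≡⟨ xy∙z≈xz∙y K (σ * t) X ⟩
    K + X + σ * t                           ∎)
    where
    open ≡-Reasoning
    t = pairs (suc m)
    K+σt≡n+mn : K + σ * t ≡ n + m * n
    K+σt≡n+mn = subst (λ k → K + σ * t ≡ k + m * k) (sym n≡mσ+p) (mtfDeficit-identity σ m p p≤σ)

  lyndonSubstrings+inversions+excess≤ : L + D + X + K ≤ N
  lyndonSubstrings+inversions+excess≤ = begin
    L + D + X + K      ≡⟨ +-assoc (L + D) X K ⟩
    L + D + (X + K)    ≡⟨ cong (L + D +_) (trans (+-comm X K) (sym equalPairs+n≡mtfDeficit+excess)) ⟩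
    (L + D) + (E + n)  ≡⟨ interchange L D E n ⟩
    (L + E) + (D + n)  ≡⟨ +-assoc (L + E) D n ⟨
    L + E + D + n      ≤⟨ +-monoˡ-≤ n (subst (λ k → L + E + D ≤ pairs (suc k)) |w|≡n (lyndonSubstrings-bound w)) ⟩
    N                  ∎
    where open ≤-Reasoning

  lyndonSubstrings≤mtf : L ≤ mtfFormula σ n m p
  lyndonSubstrings≤mtf rewrite mtfFormula≡ σ n m p =
    m+n≤o⇒m≤o∸n L (≤-trans (+-monoˡ-≤ K (≤-trans (m≤m+n L D) (m≤m+n (L + D) X))) lyndonSubstrings+inversions+excess≤)

  lyndonSubstrings≡mtf⇒sorted×balanced : L ≡ mtfFormula σ n m p → Sorted w × Balanced m w
  lyndonSubstrings≡mtf⇒sorted×balanced L≡mtf =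
    inversions≡0⇒sorted w (m+n≡0⇒m≡0 D D+X≡0) , excess≡0⇒balanced m w (m+n≡0⇒n≡0 D D+X≡0)
    where
    L+K≡N : L + K ≡ N
    L+K≡N = trans (cong (_+ K) (trans L≡mtf (mtfFormula≡ σ n m p)))
                  (m∸n+n≡m (≤-trans (m≤n+m K (L + D + X)) lyndonSubstrings+inversions+excess≤))
    D+X≤0 : (D + X) + (L + K) ≤ 0 + (L + K)
    D+X≤0 = begin
      (D + X) + (L + K)  ≡⟨ regroup D X L K ⟩
      L + D + X + K      ≤⟨ lyndonSubstrings+inversions+excess≤ ⟩
      N                  ≡⟨ L+K≡N ⟨
      L + K              ∎
      where
      open ≤-Reasoning
      regroup : ∀ d x l k → (d + x) + (l + k) ≡ l + d + x + k
      regroup = solve-∀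
    D+X≡0 : D + X ≡ 0
    D+X≡0 = n≤0⇒n≡0 (+-cancelʳ-≤ (L + K) (D + X) 0 D+X≤0)

  sorted×balanced⇒lyndonSubstrings≡mtf : Sorted w → Balanced m w → L ≡ mtfFormula σ n m p
  sorted×balanced⇒lyndonSubstrings≡mtf sorted balanced = sym (begin
    mtfFormula σ n m p  ≡⟨ mtfFormula≡ σ n m p ⟩
    N ∸ K               ≡⟨ cong (_∸ K) L+K≡N ⟨
    L + K ∸ K           ≡⟨ m+n∸n≡m L K ⟩
    L                   ∎)
    where
    open ≡-Reasoning
    L+K≡N : L + K ≡ N
    L+K≡N = begin
      L + K        ≡⟨ cong (L +_) (+-identityʳ K) ⟨
      L + (K + 0)  ≡⟨ cong (λ x → L + (K + x)) (balanced⇒excess≡0 m w balanced) ⟨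
      L + (K + X)  ≡⟨ cong (L +_) equalPairs+n≡mtfDeficit+excess ⟨
      L + (E + n)  ≡⟨ +-assoc L E n ⟨
      L + E + n    ≡⟨ cong (_+ n) (trans (lyndonSubstrings-sorted w sorted) (cong (pairs ∘ suc) |w|≡n)) ⟩
      N            ∎

-- Sorted words

module _ {σ : ℕ} where

  occ-head : ∀ x (w : Word {σ}) → occ x (x ∷ w) ≡ suc (occ x w)
  occ-head x w rewrite ≡ᵇ-refl (toℕ x) = refl

  occ-absent : ∀ {x x′} (w : Word {σ}) → x Fin.< x′ → All (x′ Fin.≤_) w → occ x (x′ ∷ w) ≡ 0
  occ-absent w x<x′ x′≤w = count-none (All.map <⇒different (x<x′ ∷ All.map (<-≤-trans x<x′) x′≤w))
    where
    <⇒different : ∀ {x y} → x Fin.< y → ¬ T (sameLetter x y)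
    <⇒different x<y = <⇒≢ x<y ∘ ≡ᵇ⇒≡ _ _

  sorted-occ-injective : ∀ (w w′ : Word {σ}) → Sorted w → Sorted w′ → (∀ i → occ i w ≡ occ i w′) → w ≡ w′
  sorted-occ-injective []      []        _ _ _    = refl
  sorted-occ-injective []      (x′ ∷ w′) _ _ same = ⊥-elim (0≢1+n (trans (same x′) (occ-head x′ w′)))
  sorted-occ-injective (x ∷ w) []        _ _ same = ⊥-elim (1+n≢0 (trans (sym (occ-head x w)) (same x)))
  sorted-occ-injective (x ∷ w) (x′ ∷ w′) (x≤w ∷ sorted) (x′≤w′ ∷ sorted′) same with <-cmp (toℕ x) (toℕ x′)
  ... | tri< x<x′ _ _ = ⊥-elim (1+n≢0 (trans (sym (occ-head x w)) (trans (same x) (occ-absent w′ x<x′ x′≤w′))))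
  ... | tri> _ _ x′<x = ⊥-elim (1+n≢0 (trans (sym (occ-head x′ w′)) (trans (sym (same x′)) (occ-absent w x′<x x≤w))))
  ... | tri≈ _ x≡x′ _ with toℕ-injective x≡x′
  ...   | refl = cong (x ∷_) (sorted-occ-injective w w′ sorted sorted′ (λ i → +-cancelˡ-≡ _ _ _ (same i)))

sortedWord : ∀ {σ} → (Fin σ → ℕ) → Word {σ}
sortedWord {zero}  f = []
sortedWord {suc σ} f = replicate (f Fin.zero) Fin.zero ++ map Fin.suc (sortedWord (f ∘ Fin.suc))

occ-sortedWord : ∀ {σ} (f : Fin σ → ℕ) i → occ i (sortedWord f) ≡ f i
occ-sortedWord {suc σ} f Fin.zero = begin
  occ Fin.zero (zeros ++ map Fin.suc rest)              ≡⟨ count-++ _ zeros _ ⟩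
  occ Fin.zero zeros + occ Fin.zero (map Fin.suc rest)  ≡⟨ cong₂ _+_ (occ-zeros (f Fin.zero)) (count-map _ Fin.suc rest) ⟩
  f Fin.zero + count (λ _ → false) rest                 ≡⟨ cong (f Fin.zero +_) (count-none (All.universal (λ _ ()) rest)) ⟩
  f Fin.zero + 0                                        ≡⟨ +-identityʳ _ ⟩
  f Fin.zero                                            ∎
  where
  open ≡-Reasoning
  zeros = replicate (f Fin.zero) Fin.zero
  rest  = sortedWord (f ∘ Fin.suc)
  occ-zeros : ∀ k → occ {suc σ} Fin.zero (replicate k Fin.zero) ≡ k
  occ-zeros zero    = refl
  occ-zeros (suc k) = cong suc (occ-zeros k)
occ-sortedWord {suc σ} f (Fin.suc i) = begin
  occ (Fin.suc i) (zeros ++ map Fin.suc rest)                 ≡⟨ count-++ _ zeros _ ⟩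
  occ (Fin.suc i) zeros + occ (Fin.suc i) (map Fin.suc rest)  ≡⟨ cong₂ _+_ (count-none (All.replicate⁺ (f Fin.zero) (λ ())))
                                                                           (count-map _ Fin.suc rest) ⟩
  occ i rest                                                  ≡⟨ occ-sortedWord (f ∘ Fin.suc) i ⟩
  f (Fin.suc i)                                               ∎
  where
  open ≡-Reasoning
  zeros = replicate (f Fin.zero) Fin.zero
  rest  = sortedWord (f ∘ Fin.suc)

sortedWord-sorted : ∀ {σ} (f : Fin σ → ℕ) → Sorted (sortedWord f)
sortedWord-sorted {zero}  f = []
sortedWord-sorted {suc σ} f =
  zeros++ (f Fin.zero) (AllPairs.map⁺ (AllPairs.map s≤s (sortedWord-sorted (f ∘ Fin.suc))))
  where
  zeros++ : ∀ k {w} → Sorted w → Sorted (replicate k Fin.zero ++ w)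
  zeros++ zero    sorted = sorted
  zeros++ (suc k) sorted = All.universal (λ _ → z≤n) _ ∷ zeros++ k sorted

length-sortedWord : ∀ {σ} (f : Fin σ → ℕ) → length (sortedWord f) ≡ ∑[ i < σ ] f i
length-sortedWord f = trans (sym (∑-occ (sortedWord f))) (sum-cong-≗ (occ-sortedWord f))

concatMap-replicate-tabulate : ∀ {σ τ} (f : Fin τ → ℕ) (h : Fin σ → Fin τ) →
  concatMap (λ i → replicate (f i) i) (tabulate h) ≡ map h (sortedWord (f ∘ h))
concatMap-replicate-tabulate {zero}  f h = refl
concatMap-replicate-tabulate {suc σ} f h = sym (begin
  map h (replicate (f (h Fin.zero)) Fin.zero ++ map Fin.suc rest)
    ≡⟨ map-++ h (replicate (f (h Fin.zero)) Fin.zero) _ ⟩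
  map h (replicate (f (h Fin.zero)) Fin.zero) ++ map h (map Fin.suc rest)
    ≡⟨ cong₂ _++_ (map-replicate h (f (h Fin.zero)) Fin.zero) (sym (map-∘ rest)) ⟩
  replicate (f (h Fin.zero)) (h Fin.zero) ++ map (h ∘ Fin.suc) rest
    ≡⟨ cong (replicate (f (h Fin.zero)) (h Fin.zero) ++_) (concatMap-replicate-tabulate f (h ∘ Fin.suc)) ⟨
  replicate (f (h Fin.zero)) (h Fin.zero) ++ concatMap (λ i → replicate (f i) i) (tabulate (h ∘ Fin.suc)) ∎)
  where
  open ≡-Reasoning
  rest = sortedWord (f ∘ h ∘ Fin.suc)

witness≡sortedWord : ∀ σ m p → witness σ m p ≡ sortedWord (λ i → if toℕ i <ᵇ (σ ∸ p) then m else suc m)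
witness≡sortedWord σ m p = trans (concatMap-replicate-tabulate _ id) (map-id _)

∑-threshold : ∀ m σ k → k ≤ σ → ∑[ i < σ ] (if toℕ i <ᵇ k then m else suc m) ≡ m * σ + (σ ∸ k)
∑-threshold m zero    zero    _         = sym (trans (+-identityʳ (m * 0)) (*-zeroʳ m))
∑-threshold m (suc σ) zero    _         = trans (cong (suc m +_) (∑-threshold m σ zero z≤n)) (regroup m σ)
  where
  regroup : ∀ m σ → suc m + (m * σ + σ) ≡ m * suc σ + suc σ
  regroup = solve-∀
∑-threshold m (suc σ) (suc k) (s≤s k≤σ) = trans (cong (m +_) (∑-threshold m σ k k≤σ)) (regroup m σ (σ ∸ k))
  where
  regroup : ∀ m σ d → m + (m * σ + d) ≡ m * suc σ + d
  regroup = solve-∀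

-- Counting the optimal words

Σ-≡ : ∀ {A : Set} {P : A → Set} → (∀ {a} (x y : P a) → x ≡ y) →
      ∀ {a b} {x : P a} {y : P b} → a ≡ b → (a , x) ≡ (b , y)
Σ-≡ irrelevant {x = x} {y} refl = cong (_ ,_) (irrelevant x y)

Fin-cong : ∀ {m n} → m ≡ n → Fin m ↔ Fin n
Fin-cong refl = ↔-refl

module _ {n : ℕ} where

  empty-subsets-of-suc : Σ (Subset (suc n)) (λ s → ∣ s ∣ ≡ 0) ↔ Σ (Subset n) (λ s → ∣ s ∣ ≡ 0)
  empty-subsets-of-suc = mk↔ₛ′
    (λ { (false ∷ s , e) → s , e })
    (λ { (s , e) → false ∷ s , e })
    (λ _ → refl)
    (λ { (false ∷ s , e) → refl })

  nonempty-subsets-of-suc : ∀ k → Σ (Subset (suc n)) (λ s → ∣ s ∣ ≡ suc k) ↔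
                            (Σ (Subset n) (λ s → ∣ s ∣ ≡ k) ⊎ Σ (Subset n) (λ s → ∣ s ∣ ≡ suc k))
  nonempty-subsets-of-suc k = mk↔ₛ′
    (λ { (true ∷ s , e) → inj₁ (s , suc-injective e) ; (false ∷ s , e) → inj₂ (s , e) })
    (λ { (inj₁ (s , e)) → true ∷ s , cong suc e ; (inj₂ (s , e)) → false ∷ s , e })
    (λ { (inj₁ (s , e)) → cong inj₁ (Σ-≡ ≡-irrelevant refl) ; (inj₂ (s , e)) → refl })
    (λ { (true ∷ s , e) → Σ-≡ ≡-irrelevant refl ; (false ∷ s , e) → refl })

subsets↔ : ∀ n k → Σ (Subset n) (λ s → ∣ s ∣ ≡ k) ↔ Fin (n C k)
subsets↔ zero    zero    = mk↔ₛ′ (λ _ → Fin.zero) (λ _ → [] , refl)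
                                 (λ { Fin.zero → refl ; (Fin.suc ()) }) (λ { ([] , refl) → refl })
subsets↔ zero    (suc k) = mk↔ₛ′ (λ { ([] , ()) }) (λ ()) (λ ()) (λ { ([] , ()) })
subsets↔ (suc n) zero    = ↔-trans empty-subsets-of-suc (subsets↔ n zero)
subsets↔ (suc n) (suc k) =
  ↔-trans (nonempty-subsets-of-suc k)
  (↔-trans (subsets↔ n k ⊎-↔ subsets↔ n (suc k))
  (↔-trans (↔-sym +↔⊎)
           (Fin-cong (nCk+nC[k+1]≡[n+1]C[k+1] n k))))

module _ {σ : ℕ} (m : ℕ) where

  profile : Subset σ → Fin σ → ℕ
  profile s i = if lookup s i then suc m else m

  heavyLetters : Word {σ} → Subset σ
  heavyLetters w = Vec.tabulate (λ i → occ i w ≡ᵇ suc m)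

  profile-balanced : ∀ s → Balanced m (sortedWord (profile s))
  profile-balanced s i rewrite occ-sortedWord (profile s) i with lookup s i
  ... | true  = inj₂ refl
  ... | false = inj₁ refl

  heavyLetters-profile : ∀ s → heavyLetters (sortedWord (profile s)) ≡ s
  heavyLetters-profile s = trans (tabulate-cong heavy≡lookup) (tabulate∘lookup s)
    where
    heavy≡lookup : ∀ i → (occ i (sortedWord (profile s)) ≡ᵇ suc m) ≡ lookup s i
    heavy≡lookup i rewrite occ-sortedWord (profile s) i with lookup s i
    ... | true  = ≡ᵇ-refl m
    ... | false = ≡ᵇ-1+n m

  balanced⇒occ≡profile : ∀ w → Balanced m w → ∀ i → occ i w ≡ profile (heavyLetters w) i
  balanced⇒occ≡profile w balanced i rewrite lookup∘tabulate (λ i → occ i w ≡ᵇ suc m) i with balanced i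
  ... | inj₁ occ≡m   rewrite occ≡m   | ≡ᵇ-1+n m  = refl
  ... | inj₂ occ≡1+m rewrite occ≡1+m | ≡ᵇ-refl m = refl

∑-profile : ∀ {σ} m (s : Subset σ) → ∑[ i < σ ] profile m s i ≡ m * σ + ∣ s ∣
∑-profile m []          = sym (trans (+-identityʳ (m * 0)) (*-zeroʳ m))
∑-profile m (true ∷ s)  = trans (cong (suc m +_) (∑-profile m s)) (regroup m _ ∣ s ∣)
  where
  regroup : ∀ m σ k → suc m + (m * σ + k) ≡ m * suc σ + suc k
  regroup = solve-∀
∑-profile m (false ∷ s) = trans (cong (m +_) (∑-profile m s)) (regroup m _ ∣ s ∣)
  where
  regroup : ∀ m σ k → m + (m * σ + k) ≡ m * suc σ + k
  regroup = solve-∀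

module _ {σ n m p : ℕ} (n≡mσ+p : n ≡ m * σ + p) (p≤σ : p ≤ σ) where

  Optimal : Set
  Optimal = Σ (Word {σ}) (λ w → length w ≡ n × lyndonSubstrings w ≡ mtfFormula σ n m p)

  length-sortedWord-profile : ∀ s → ∣ s ∣ ≡ p → length (sortedWord (profile m s)) ≡ n
  length-sortedWord-profile s ∣s∣≡p = begin
    length (sortedWord (profile m s))  ≡⟨ length-sortedWord (profile m s) ⟩
    ∑[ i < σ ] profile m s i           ≡⟨ ∑-profile m s ⟩
    m * σ + ∣ s ∣                      ≡⟨ cong (m * σ +_) ∣s∣≡p ⟩
    m * σ + p                          ≡⟨ n≡mσ+p ⟨
    n                                  ∎
    where open ≡-Reasoning

  optimal↔subsets : Optimal ↔ Σ (Subset σ) (λ s → ∣ s ∣ ≡ p)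
  optimal↔subsets = mk↔ₛ′ to from to∘from from∘to
    where
    sorted×balanced : ((w , |w|≡n , _) : Optimal) → Sorted w × Balanced m w
    sorted×balanced (w , |w|≡n , L≡mtf) = lyndonSubstrings≡mtf⇒sorted×balanced n≡mσ+p p≤σ w |w|≡n L≡mtf

    to : Optimal → Σ (Subset σ) (λ s → ∣ s ∣ ≡ p)
    to optimal@(w , |w|≡n , _) = heavyLetters m w , +-cancelˡ-≡ (m * σ) _ _ (begin
      m * σ + ∣ heavyLetters m w ∣               ≡⟨ ∑-profile m (heavyLetters m w) ⟨
      ∑[ i < σ ] profile m (heavyLetters m w) i  ≡⟨ sum-cong-≗ (balanced⇒occ≡profile m w (proj₂ (sorted×balanced optimal))) ⟨
      ∑[ i < σ ] occ i w                         ≡⟨ ∑-occ w ⟩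
      length w                                   ≡⟨ trans |w|≡n n≡mσ+p ⟩
      m * σ + p                                  ∎)
      where open ≡-Reasoning

    from : Σ (Subset σ) (λ s → ∣ s ∣ ≡ p) → Optimal
    from (s , ∣s∣≡p) = sortedWord (profile m s) , |w|≡n ,
      sorted×balanced⇒lyndonSubstrings≡mtf n≡mσ+p p≤σ _ |w|≡n (sortedWord-sorted (profile m s)) (profile-balanced m s)
      where |w|≡n = length-sortedWord-profile s ∣s∣≡p

    to∘from : ∀ s → to (from s) ≡ s
    to∘from (s , _) = Σ-≡ ≡-irrelevant (heavyLetters-profile m s)

    from∘to : ∀ w → from (to w) ≡ w
    from∘to optimal@(w , _) with sorted×balanced optimal
    ... | sorted , balanced = Σ-≡ (λ (a , b) (c , d) → cong₂ _,_ (≡-irrelevant a c) (≡-irrelevant b d))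
      (sorted-occ-injective _ w (sortedWord-sorted _) sorted
        (λ i → trans (occ-sortedWord _ i) (sym (balanced⇒occ≡profile m w balanced i))))

  witness-optimal : length (witness σ m p) ≡ n × lyndonSubstrings (witness σ m p) ≡ mtfFormula σ n m p
  witness-optimal rewrite witness≡sortedWord σ m p =
    |w|≡n , sorted×balanced⇒lyndonSubstrings≡mtf n≡mσ+p p≤σ _ |w|≡n (sortedWord-sorted F) balanced
    where
    F : Fin σ → ℕ
    F i = if toℕ i <ᵇ (σ ∸ p) then m else suc m
    |w|≡n : length (sortedWord F) ≡ n
    |w|≡n = begin
      length (sortedWord F)  ≡⟨ length-sortedWord F ⟩
      ∑[ i < σ ] F i         ≡⟨ ∑-threshold m σ (σ ∸ p) (m∸n≤m σ p) ⟩
      m * σ + (σ ∸ (σ ∸ p))  ≡⟨ cong (m * σ +_) (m∸[m∸n]≡n p≤σ) ⟩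
      m * σ + p              ≡⟨ n≡mσ+p ⟨
      n                      ∎
      where open ≡-Reasoning
    balanced : Balanced m (sortedWord F)
    balanced i rewrite occ-sortedWord F i with toℕ i <ᵇ (σ ∸ p)
    ... | true  = inj₁ refl
    ... | false = inj₂ refl

mainTheorem2 : (σ n m p : ℕ) → σ < n → n ≡ m * σ + p → p < σ →
    ((w : List (Fin σ)) → length w ≡ n → lyndonSubstrings w ≤ mtfFormula σ n m p)
    × (Σ (List (Fin σ)) (λ w → length w ≡ n × lyndonSubstrings w ≡ mtfFormula σ n m p)
        ↔ Fin (σ C p))
    × (length (witness σ m p) ≡ n × lyndonSubstrings (witness σ m p) ≡ mtfFormula σ n m p)
mainTheorem2 σ n m p _ n≡mσ+p p<σ =
  lyndonSubstrings≤mtf {m = m} n≡mσ+p p≤σ ,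
  ↔-trans (optimal↔subsets {m = m} n≡mσ+p p≤σ) (subsets↔ σ p) ,
  witness-optimal {m = m} n≡mσ+p p≤σ
  where
  p≤σ = <⇒≤ p<σ
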